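{- Let $n,k\ge 1$ be integers and let $G_{2n}(k+1)$ be the simple graph with vertex set $$\{u_i, v_i : 1\le i\le 2k+1\}\cup\{y_{i,j}, z_{i,j} : 1\le i\le k,\ 1\le j\le 2n\}\cup\{x_{k+1,j} : 1\le j\le 2n\}$$ and edge set consisting of - $u_iv_i$ for $1\le i\le 2k+1$; - $u_iy_{i,j}$, $v_{2k+2-i}y_{i,j}$, $v_iz_{i,j}$, $u_{2k+2-i}z_{i,j}$ for $1\le i\le k$ and $1\le j\le 2n$; - $u_{k+1}x_{k+1,j}$, $v_{k+1}x_{k+1,j}$ for $1\le j\le 2n$. This graph has $k+1$ components: $k$ of them are the graphs on $\{u_i,v_i,u_{2k+2-i},v_{2k+2-i},y_{i,j},z_{i,j}\}$, and the remaining one is a copy of $P_2\vee O_{2n}$. Then $\chi_{la}(G_{2n}(k+1))=3$.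
   Context: For a graph $G$ with $q$ edges, a local antimagic labeling is a bijection $f:E(G)\to\{1,2,\dots,q\}$ such that $f^+(u)\ne f^+(v)$ for every edge $uv\in E(G)$. Here $f^+(u)=\sum_{e\ni u} f(e)$ is the sum of the labels of the edges incident to $u$. The color number of $f$ is the number of distinct values of $f^+$. The local antimagic chromatic number $\chi_{la}(G)$ is the minimum color number over all local antimagic labelings of $G$. $P_2\vee O_m$ denotes the join of an edge with an edgeless graph on $m$ vertices. -}

module Defs where

open import Data.Nat using (ℕ; zero; suc; _+_; _*_; _≤_; _<_; s≤s)
open import Data.Nat.Properties using (≤-trans; m≤m+n; n≤1+n; ≤-refl)
open import Data.Fin using (Fin; toℕ; splitAt; remQuot; inject≤; opposite; fromℕ<)
import Data.Fin.Properties as FinP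
open import Data.Bool using (if_then_else_; _∨_)
open import Data.List using (List; map; allFin; length)
open import Data.Nat.ListAction using (sum)
open import Data.List.Membership.Propositional using (_∈_)
open import Data.List.Relation.Unary.Unique.Propositional using (Unique)
open import Data.Product using (Σ; ∃; _×_; _,_; proj₁; proj₂)
open import Data.Sum using (_⊎_; inj₁; inj₂)
open import Function.Bundles using (_⤖_; Bijection)
open import Relation.Binary.Definitions using (DecidableEquality)
open import Relation.Binary.PropositionalEquality using (_≡_; _≢_; refl; cong; cong₂)
open import Relation.Nullary using (yes; no; ⌊_⌋)

record Graph : Set₁ where
  field
    V    : Set
    _≟V_ : DecidableEquality V
    q    : ℕ
    ends : Fin q → V × V

open Graph public

-- A labeling is a bijection E(G) → {1,…,q}; we use a bijection
-- Fin q ⤖ Fin q, edge e receiving label  toℕ (σ e) + 1.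
Labeling : Graph → Set
Labeling G = Fin (q G) ⤖ Fin (q G)

label : (G : Graph) → Labeling G → Fin (q G) → ℕ
label G f e = suc (toℕ (Bijection.to f e))

fplus : (G : Graph) → Labeling G → V G → ℕ
fplus G f w = sum (map term (allFin (q G)))
  where
  term : Fin (q G) → ℕ
  term e = if ⌊ (_≟V_ G) w (proj₁ (ends G e)) ⌋ ∨ ⌊ (_≟V_ G) w (proj₂ (ends G e)) ⌋
           then label G f e else 0

LocalAntimagic : (G : Graph) → Labeling G → Set
LocalAntimagic G f = ∀ e → fplus G f (proj₁ (ends G e)) ≢ fplus G f (proj₂ (ends G e))

ColorNumber : (G : Graph) → Labeling G → ℕ → Set
ColorNumber G f c =
  Σ (List ℕ) λ L → Unique L × (∀ w → fplus G f w ∈ L)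
                 × (∀ a → a ∈ L → ∃ λ w → fplus G f w ≡ a) × length L ≡ c

χla≡ : Graph → ℕ → Set
χla≡ G c =
  (Σ (Labeling G) λ f → LocalAntimagic G f × ColorNumber G f c)
  × (∀ f → LocalAntimagic G f → ∀ c′ → ColorNumber G f c′ → c ≤ c′)

-- The graph G_{2n}(k+1).  Indices are 0-based: u i, v i for i : Fin (2k+1)
-- stand for u_{i+1}, v_{i+1}; y i j, z i j for y_{i+1,j+1}, z_{i+1,j+1};
-- x j for x_{k+1,j+1}.

data Vtx (n k : ℕ) : Set where
  u v : Fin (suc (k + k)) → Vtx n k
  y z : Fin k → Fin (n + n) → Vtx n k
  x   : Fin (n + n) → Vtx n k

module _ {n k : ℕ} where
  _≟Vtx_ : DecidableEquality (Vtx n k)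
  u i ≟Vtx u i′ with i FinP.≟ i′
  ... | yes refl = yes refl
  ... | no ne = no λ { refl → ne refl }
  v i ≟Vtx v i′ with i FinP.≟ i′
  ... | yes refl = yes refl
  ... | no ne = no λ { refl → ne refl }
  y i j ≟Vtx y i′ j′ with i FinP.≟ i′ | j FinP.≟ j′
  ... | yes refl | yes refl = yes refl
  ... | no ne | _ = no λ { refl → ne refl }
  ... | _ | no ne = no λ { refl → ne refl }
  z i j ≟Vtx z i′ j′ with i FinP.≟ i′ | j FinP.≟ j′
  ... | yes refl | yes refl = yes refl
  ... | no ne | _ = no λ { refl → ne refl }
  ... | _ | no ne = no λ { refl → ne refl }
  x j ≟Vtx x j′ with j FinP.≟ j′
  ... | yes refl = yes refl
  ... | no ne = no λ { refl → ne refl }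
  u _ ≟Vtx v _ = no λ ()
  u _ ≟Vtx y _ _ = no λ ()
  u _ ≟Vtx z _ _ = no λ ()
  u _ ≟Vtx x _ = no λ ()
  v _ ≟Vtx u _ = no λ ()
  v _ ≟Vtx y _ _ = no λ ()
  v _ ≟Vtx z _ _ = no λ ()
  v _ ≟Vtx x _ = no λ ()
  y _ _ ≟Vtx u _ = no λ ()
  y _ _ ≟Vtx v _ = no λ ()
  y _ _ ≟Vtx z _ _ = no λ ()
  y _ _ ≟Vtx x _ = no λ ()
  z _ _ ≟Vtx u _ = no λ ()
  z _ _ ≟Vtx v _ = no λ ()
  z _ _ ≟Vtx y _ _ = no λ ()
  z _ _ ≟Vtx x _ = no λ ()
  x _ ≟Vtx u _ = no λ ()
  x _ ≟Vtx v _ = no λ ()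
  x _ ≟Vtx y _ _ = no λ ()
  x _ ≟Vtx z _ _ = no λ ()

qG : ℕ → ℕ → ℕ
qG n k = suc (k + k) + (k * (n + n) + (k * (n + n) + (k * (n + n) + (k * (n + n) + ((n + n) + (n + n))))))

lo : {k : ℕ} → Fin k → Fin (suc (k + k))
lo {k} i = inject≤ i (≤-trans (m≤m+n k k) (n≤1+n (k + k)))

-- i ↦ index of v_{2k+2-(i+1)}, i.e. 0-based 2k - i
hi : {k : ℕ} → Fin k → Fin (suc (k + k))
hi i = opposite (lo i)

mid : (k : ℕ) → Fin (suc (k + k))
mid k = fromℕ< (s≤s (m≤m+n k k))

endsG : (n k : ℕ) → Fin (qG n k) → Vtx n k × Vtx n k
endsG n k e with splitAt (suc (k + k)) e
... | inj₁ i = u i , v i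
... | inj₂ e₁ with splitAt (k * (n + n)) e₁
...   | inj₁ ij = let (i , j) = remQuot (n + n) ij in u (lo i) , y i j
...   | inj₂ e₂ with splitAt (k * (n + n)) e₂
...     | inj₁ ij = let (i , j) = remQuot (n + n) ij in v (hi i) , y i j
...     | inj₂ e₃ with splitAt (k * (n + n)) e₃
...       | inj₁ ij = let (i , j) = remQuot (n + n) ij in v (lo i) , z i j
...       | inj₂ e₄ with splitAt (k * (n + n)) e₄
...         | inj₁ ij = let (i , j) = remQuot (n + n) ij in u (hi i) , z i j
...         | inj₂ e₅ with splitAt (n + n) e₅
...           | inj₁ j = u (mid k) , x j
...           | inj₂ j = v (mid k) , x j

G2n : (n k : ℕ) → Graph
G2n n k = record { V = Vtx n k ; _≟V_ = _≟Vtx_ ; q = qG n k ; ends = endsG n k }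

-- Index the leaves y, z, x uniformly as leaf j col (j < 2n, col one of 2k + 1 columns), so that the
-- leaves of a column hang from u_a and v_(2k−a) for a = anchor col (0-based). There are P = 2n(2k + 1)
-- leaves; label the u-legs 1 … P, the v-leg at the same leaf with the mirror label in P + 1 … 2P, and
-- the rung u_a v_a with 2P + 1 + a, so that every leaf sums to 2P + 1. The u-leg j of column col gets
-- label (2k + 1) j + ρ_j(col) + 1, where every ρ_j maps the columns bijectively onto 0 … 2k: two of
-- them are the lower rows of a 3 × (2k + 1) magic rectangle with first row anchor, the others are
-- n − 1 copies each of anchor and of its mirror image 2k − anchor. Hence anchor + ∑_j ρ_j is constant
-- and all u_a get the same sum; as every leaf sums to a constant, so do all v_a. The three sums are
-- distinct, and the triangle u_(k+1), v_(k+1), x_(k+1,1) rules out fewer than three colors.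

module Submission where

open import Data.Nat using (ℕ; zero; suc; _+_; _*_; _≤_; _<_; s≤s; z≤n)
open import Data.Nat.Properties
  using ( +-0-commutativeMonoid; +-*-semiring; +-assoc; +-comm; +-identityʳ; *-identityʳ; *-distribˡ-+
        ; *-comm; +-cancelˡ-≡; +-cancelʳ-≡; +-cancelˡ-<; +-monoˡ-<; +-monoʳ-<; m≤m+n; m<m+n; m+[n∸m]≡n
        ; <-trans; <-≤-trans; <-irrefl; <⇒≢; >⇒≢; <-cmp; suc-injective)
open import Data.Nat.Tactic.RingSolver using (solve-∀)
open import Data.Fin as Fin
  using ( Fin; zero; suc; toℕ; fromℕ; fromℕ<; inject₁; cast; opposite; _↑ˡ_; _↑ʳ_; splitAt; join; quotRem
        ; combine; punchIn; punchOut)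
open import Data.Fin.Properties
  using ( toℕ-injective; toℕ<n; toℕ≤pred[n]; toℕ-fromℕ; toℕ-fromℕ<; toℕ-inject₁; toℕ-inject≤; toℕ-cast
        ; toℕ-↑ˡ; toℕ-↑ʳ; toℕ-combine; inject₁-injective; fromℕ≢inject₁; ↑ˡ-injective; ↑ʳ-injective
        ; combine-injective; combine-remQuot; remQuot-combine; splitAt-join; join-splitAt; opposite-prop
        ; opposite-involutive; punchInᵢ≢i; punchOut-injective; any?; injective⇒≤)
  renaming (suc-injective to fsuc-injective)
open import Data.Vec.Functional using (Vector; _++_; concat)
open import Data.Vec.Functional.Properties using (lookup-++ˡ; lookup-++ʳ)
open import Data.List as List using (List; []; _∷_; tabulate; lookup)
open import Data.List.Properties using (map-tabulate)
import Data.Nat.ListAction as ListAction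
open import Data.List.Relation.Unary.Any using (here; there; index)
open import Data.List.Relation.Unary.Any.Properties using (lookup-index)
open import Data.List.Relation.Unary.All using ([]; _∷_)
open import Data.List.Relation.Unary.AllPairs using ([]; _∷_)
open import Data.List.Relation.Unary.Unique.Propositional using (Unique)
open import Data.List.Membership.Propositional using (_∈_)
open import Data.Bool using (if_then_else_; _∨_)
open import Data.Product as Product using (∃-syntax; _×_; _,_; proj₁; proj₂; uncurry)
open import Data.Sum as Sum using (_⊎_; inj₁; inj₂)
open import Function using (id; _∘_; flip)
open import Function.Definitions using (Injective; Surjective)
open import Function.Bundles using (mk⤖)
open import Relation.Nullary using (yes; no; ⌊_⌋; contradiction)
open import Relation.Binary.Definitions using (tri<; tri≈; tri>)
open import Relation.Binary.PropositionalEquality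
open ≡-Reasoning
open import Algebra.Properties.CommutativeMonoid.Sum +-0-commutativeMonoid
  using (sum-syntax; sum-cong-≗; sum-replicate-zero; sum-remove; ∑-distrib-+)
open import Algebra.Properties.Semiring.Sum +-*-semiring using (*-distribˡ-sum)

open import Defs

-- Finite sums

∑-zero : ∀ {m} {g : Fin m → ℕ} → (∀ i → g i ≡ 0) → ∑[ i < m ] g i ≡ 0
∑-zero {m} g≗0 = trans (sum-cong-≗ g≗0) (sum-replicate-zero m)

∑-single : ∀ {m} (g : Fin m → ℕ) i → (∀ j → j ≢ i → g j ≡ 0) → ∑[ j < m ] g j ≡ g i
∑-single {suc m} g i g≗0 = begin
  ∑[ j < suc m ] g j                ≡⟨ sum-remove {i = i} g ⟩
  g i + ∑[ j < m ] g (punchIn i j)  ≡⟨ cong (g i +_) (∑-zero (λ j → g≗0 (punchIn i j) (punchInᵢ≢i i j))) ⟩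
  g i + 0                           ≡⟨ +-identityʳ (g i) ⟩
  g i                               ∎

∑-const : ∀ m c → ∑[ i < m ] c ≡ m * c
∑-const zero    c = refl
∑-const (suc m) c = cong (c +_) (∑-const m c)

∑-suc : ∀ m (g : Fin m → ℕ) → ∑[ i < m ] suc (g i) ≡ m + ∑[ i < m ] g i
∑-suc m g = trans (∑-distrib-+ (λ _ → 1) g) (cong (_+ ∑[ i < m ] g i) (trans (∑-const m 1) (*-identityʳ m)))

∑-toℕ : ∀ m → 2 * ∑[ i < suc m ] toℕ i ≡ suc m * m
∑-toℕ zero    = refl
∑-toℕ (suc m) = begin
  2 * ∑[ i < suc m ] suc (toℕ i)        ≡⟨ cong (2 *_) (∑-suc (suc m) toℕ) ⟩
  2 * (suc m + ∑[ i < suc m ] toℕ i)    ≡⟨ *-distribˡ-+ 2 (suc m) _ ⟩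
  2 * suc m + 2 * ∑[ i < suc m ] toℕ i  ≡⟨ cong (2 * suc m +_) (∑-toℕ m) ⟩
  2 * suc m + suc m * m                 ≡⟨ gauss-step m ⟩
  suc (suc m) * suc m                   ∎
  where
  gauss-step : ∀ m → 2 * suc m + suc m * m ≡ suc (suc m) * suc m
  gauss-step = solve-∀

∑-splitAt : ∀ m {n} (g : Fin m ⊎ Fin n → ℕ) →
            ∑[ e < m + n ] g (splitAt m e) ≡ ∑[ i < m ] g (inj₁ i) + ∑[ j < n ] g (inj₂ j)
∑-splitAt zero    g = refl
∑-splitAt (suc m) g =
  trans (cong (g (inj₁ zero) +_) (∑-splitAt m (g ∘ Sum.map₁ suc))) (sym (+-assoc (g (inj₁ zero)) _ _))

∑-++ : ∀ {a b} {A : Set} (h : A → ℕ) (xs : Vector A a) (ys : Vector A b) →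
       ∑[ e < a + b ] h ((xs ++ ys) e) ≡ ∑[ i < a ] h (xs i) + ∑[ j < b ] h (ys j)
∑-++ {a} h xs ys = ∑-splitAt a (h ∘ Sum.[ xs , ys ])

∑-concat : ∀ {a b} {A : Set} (h : A → ℕ) (xss : Vector (Vector A b) a) →
           ∑[ t < a * b ] h (concat xss t) ≡ ∑[ i < a ] ∑[ j < b ] h (xss i j)
∑-concat {zero}      h xss = refl
∑-concat {suc a} {b} h xss =
  trans (∑-splitAt b (h ∘ uncurry (flip xss) ∘ Sum.[ (_, zero) , Product.map₂ suc ∘ quotRem b ]′))
        (cong (∑[ j < b ] h (xss zero j) +_) (∑-concat h (xss ∘ suc)))

sum-tabulate : ∀ m (g : Fin m → ℕ) → ListAction.sum (tabulate g) ≡ ∑[ i < m ] g i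
sum-tabulate zero    g = refl
sum-tabulate (suc m) g = cong (g zero +_) (sum-tabulate m (g ∘ suc))

-- Injections and enumerations on Fin

leftInverse⇒injective : ∀ {A B : Set} {f : A → B} (g : B → A) → (∀ a → g (f a) ≡ a) →
                        Injective _≡_ _≡_ f
leftInverse⇒injective {f = f} g g∘f≗id {a} {b} fa≡fb = begin
  a          ≡⟨ g∘f≗id a ⟨
  g (f a)    ≡⟨ cong g fa≡fb ⟩
  g (f b)    ≡⟨ g∘f≗id b ⟩
  b          ∎

opposite-injective : ∀ {n} → Injective _≡_ _≡_ (opposite {n})
opposite-injective = leftInverse⇒injective opposite opposite-involutive

join-injective : ∀ m n → Injective _≡_ _≡_ (join m n)
join-injective m n = leftInverse⇒injective (splitAt m) (splitAt-join m n)

toℕ+toℕ-opposite : ∀ {n} (i : Fin n) → suc (toℕ i + toℕ (opposite i)) ≡ n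
toℕ+toℕ-opposite {suc n} i = cong suc (trans (cong (toℕ i +_) (opposite-prop i)) (m+[n∸m]≡n (toℕ≤pred[n] i)))

injective⇒surjective : ∀ {m} (f : Fin m → Fin m) → Injective _≡_ _≡_ f → Surjective _≡_ _≡_ f
injective⇒surjective {suc m} f f-injective i with any? (λ j → f j Fin.≟ i)
... | yes (j , fj≡i) = j , λ { refl → fj≡i }
... | no ∄j = contradiction (injective⇒≤ avoid-injective) (<-irrefl refl)
  where
  i≢f : ∀ j → i ≢ f j
  i≢f j i≡fj = ∄j (j , sym i≡fj)
  avoid : Fin (suc m) → Fin m
  avoid j = punchOut (i≢f j)
  avoid-injective : Injective _≡_ _≡_ avoid
  avoid-injective {a} {b} eq = f-injective (punchOut-injective (i≢f a) (i≢f b) eq)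

lookup-concat : ∀ {a b} {A : Set} (xss : Vector (Vector A b) a) i j → concat xss (combine i j) ≡ xss i j
lookup-concat xss i j = cong (uncurry (flip xss) ∘ Product.swap) (remQuot-combine i j)

++-leftInverse : ∀ {a b} {A B : Set} (xs : Vector A a) (ys : Vector A b) (r : A → B) (ι : Fin (a + b) → B) →
                 (∀ i → r (xs i) ≡ ι (i ↑ˡ b)) → (∀ j → r (ys j) ≡ ι (a ↑ʳ j)) →
                 ∀ e → r ((xs ++ ys) e) ≡ ι e
++-leftInverse {a} {b} xs ys r ι r∘xs r∘ys e = trans (by-block (splitAt a e)) (cong ι (join-splitAt a b e))
  where
  by-block : ∀ s → r (Sum.[ xs , ys ] s) ≡ ι (join a b s)
  by-block (inj₁ i) = r∘xs i
  by-block (inj₂ j) = r∘ys j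

concat-leftInverse : ∀ {a b} {A B : Set} (xss : Vector (Vector A b) a) (r : A → B) (ι : Fin (a * b) → B) →
                     (∀ i j → r (xss i j) ≡ ι (combine i j)) → ∀ t → r (concat xss t) ≡ ι t
concat-leftInverse {a} {b} xss r ι r∘xss t = trans (r∘xss _ _) (cong ι (combine-remQuot {a} b t))

-- Local antimagic labelings of an arbitrary graph

module _ (G : Graph) where

  incidentLabel : V G → V G × V G → ℕ → ℕ
  incidentLabel w (a , b) ℓ = if ⌊ _≟V_ G w a ⌋ ∨ ⌊ _≟V_ G w b ⌋ then ℓ else 0

  fplus-∑ : ∀ f w → fplus G f w ≡ ∑[ e < q G ] incidentLabel w (ends G e) (label G f e)
  fplus-∑ f w = trans (cong ListAction.sum (map-tabulate id summand)) (sum-tabulate (q G) summand)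
    where
    summand : Fin (q G) → ℕ
    summand e = incidentLabel w (ends G e) (label G f e)

  incidentLabel-endpoint : ∀ {w} p ℓ → w ≡ proj₁ p ⊎ w ≡ proj₂ p → incidentLabel w p ℓ ≡ ℓ
  incidentLabel-endpoint {w} (a , b) ℓ w∈ab with _≟V_ G w a | _≟V_ G w b
  ... | yes _ | _     = refl
  ... | no _  | yes _ = refl
  ... | no w≢a | no w≢b = contradiction w∈ab Sum.[ w≢a , w≢b ]

  incidentLabel-elsewhere : ∀ {w} p ℓ → w ≢ proj₁ p → w ≢ proj₂ p → incidentLabel w p ℓ ≡ 0
  incidentLabel-elsewhere {w} (a , b) ℓ w≢a w≢b with _≟V_ G w a | _≟V_ G w b
  ... | yes w≡a | _       = contradiction w≡a w≢a
  ... | no _    | yes w≡b = contradiction w≡b w≢b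
  ... | no _    | no _    = refl

  Adjacent : V G → V G → Set
  Adjacent a b = ∃[ e ] (ends G e ≡ (a , b) ⊎ ends G e ≡ (b , a))

  Adjacent-sym : ∀ {a b} → Adjacent a b → Adjacent b a
  Adjacent-sym = Product.map₂ Sum.swap

  antimagic⇒adjacent-≢ : ∀ {f a b} → LocalAntimagic G f → Adjacent a b → fplus G f a ≢ fplus G f b
  antimagic⇒adjacent-≢ {f} antimagic (e , inj₁ ends≡ab) =
    subst (λ p → fplus G f (proj₁ p) ≢ fplus G f (proj₂ p)) ends≡ab (antimagic e)
  antimagic⇒adjacent-≢ {f} antimagic (e , inj₂ ends≡ba) =
    ≢-sym (subst (λ p → fplus G f (proj₁ p) ≢ fplus G f (proj₂ p)) ends≡ba (antimagic e))

  IsClique : ∀ {m} → (Fin m → V G) → Set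
  IsClique τ = ∀ i j → i ≢ j → Adjacent (τ i) (τ j)

  clique≤colorNumber : ∀ {m f c} (τ : Fin m → V G) → IsClique τ →
                       LocalAntimagic G f → ColorNumber G f c → m ≤ c
  clique≤colorNumber {m} {f} τ clique antimagic (colors , _ , colored , _ , refl) =
    injective⇒≤ slot-injective
    where
    slot : Fin m → Fin (List.length colors)
    slot i = index (colored (τ i))
    slot-injective : Injective _≡_ _≡_ slot
    slot-injective {i} {j} eq with i Fin.≟ j
    ... | yes i≡j = i≡j
    ... | no i≢j  = contradiction same-color (antimagic⇒adjacent-≢ {f = f} antimagic (clique i j i≢j))
      where
      same-color : fplus G f (τ i) ≡ fplus G f (τ j)
      same-color = begin
        fplus G f (τ i)         ≡⟨ lookup-index (colored (τ i)) ⟩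
        lookup colors (slot i)  ≡⟨ cong (lookup colors) eq ⟩
        lookup colors (slot j)  ≡⟨ lookup-index (colored (τ j)) ⟨
        fplus G f (τ j)         ∎

-- Arithmetic of the three color classes

edge-count : ∀ n k → let N = suc (k + k) ; T = k * (n + n) ; P = (n + n) * N in
             N + (T + (T + (T + (T + ((n + n) + (n + n)))))) ≡ P + (P + N)
edge-count = solve-∀

-- The hypothesis is Gauss's formula 2 ∑_(j<m) j = m (m − 1) for m = 2 (n′ + 1).
color-balance : ∀ n′ k G → 2 * G ≡ (suc n′ + suc n′) * (n′ + suc n′) →
                 let m = suc n′ + suc n′ ; N = suc (k + k) ; P = m * N
                     uColor = suc (P + P) + (m + N * G + (3 * k + n′ * (k + k)))
                 in uColor + m * P + uColor ≡ suc (suc (P + P + (P + P) + (k + k))) + m * suc (P + P)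
color-balance n′ k G gauss =
  +-cancelʳ-≡ (N * (m * (n′ + suc n′))) _ _ (trans (exchange n′ k G) (cong (balance +_) (cong (N *_) gauss)))
  where
  m N P balance : ℕ
  m = suc n′ + suc n′
  N = suc (k + k)
  P = m * N
  balance = suc (suc (P + P + (P + P) + (k + k))) + m * suc (P + P)
  exchange : ∀ n′ k G → let m = suc n′ + suc n′ ; N = suc (k + k) ; P = m * N
                            uColor = suc (P + P) + (m + N * G + (3 * k + n′ * (k + k)))
                        in uColor + m * P + uColor + N * (m * (n′ + suc n′))
                           ≡ suc (suc (P + P + (P + P) + (k + k))) + m * suc (P + P) + N * (2 * G)
  exchange = solve-∀

-- The labeling of G₂ₙ(k + 1)

module Construction (n′ k : ℕ) where

  -- N rungs u a — v a, m = 2n leaves in each of the N columns, P = m N legs of each kind.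
  n m N P : ℕ
  n = suc n′
  m = n + n
  N = suc (k + k)
  P = m * N

  graph : Graph
  graph = G2n n k

  data Col : Set where
    L H : Fin k → Col
    Mid : Col

  anchor : Col → Fin N
  anchor (L i) = lo i
  anchor (H i) = hi i
  anchor Mid   = mid k

  swap : Col → Col
  swap (L i) = H i
  swap (H i) = L i
  swap Mid   = Mid

  leaf : Fin m → Col → Vtx n k
  leaf j (L i) = y i j
  leaf j (H i) = z i j
  leaf j Mid   = x j

  data Edge : Set where
    rung      : Fin N → Edge
    uleg vleg : Fin m → Col → Edge

  endpoints : Edge → Vtx n k × Vtx n k
  endpoints (rung a)     = u a , v a
  endpoints (uleg j col) = u (anchor col) , leaf j col
  endpoints (vleg j col) = v (anchor (swap col)) , leaf j col

  -- edges lists the edges block by block in the order of endsG, so that endsG-edges holds by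
  -- computation; edgesFromᵢ lists the blocks from the i-th on, and shiftᵢ is its offset in edges.
  legs : (Fin m → Col → Edge) → (Fin k → Col) → Vector Edge (k * m)
  legs leg col = concat (λ i j → leg j (col i))

  edgesFrom₅ : Vector Edge (m + m)
  edgesFrom₅ = flip uleg Mid ++ flip vleg Mid

  edgesFrom₄ : Vector Edge (k * m + (m + m))
  edgesFrom₄ = legs uleg H ++ edgesFrom₅

  edgesFrom₃ : Vector Edge (k * m + (k * m + (m + m)))
  edgesFrom₃ = legs vleg H ++ edgesFrom₄

  edgesFrom₂ : Vector Edge (k * m + (k * m + (k * m + (m + m))))
  edgesFrom₂ = legs vleg L ++ edgesFrom₃

  edgesFrom₁ : Vector Edge (k * m + (k * m + (k * m + (k * m + (m + m)))))
  edgesFrom₁ = legs uleg L ++ edgesFrom₂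

  edges : Vector Edge (qG n k)
  edges = rung ++ edgesFrom₁

  shift₁ : Fin (k * m + (k * m + (k * m + (k * m + (m + m))))) → Fin (qG n k)
  shift₁ = N ↑ʳ_

  shift₂ : Fin (k * m + (k * m + (k * m + (m + m)))) → Fin (qG n k)
  shift₂ = shift₁ ∘ (k * m ↑ʳ_)

  shift₃ : Fin (k * m + (k * m + (m + m))) → Fin (qG n k)
  shift₃ = shift₂ ∘ (k * m ↑ʳ_)

  shift₄ : Fin (k * m + (m + m)) → Fin (qG n k)
  shift₄ = shift₃ ∘ (k * m ↑ʳ_)

  shift₅ : Fin (m + m) → Fin (qG n k)
  shift₅ = shift₄ ∘ (k * m ↑ʳ_)

  position : Edge → Fin (qG n k)
  position (rung a)       = a ↑ˡ _
  position (uleg j (L i)) = shift₁ (combine i j ↑ˡ _)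
  position (vleg j (L i)) = shift₂ (combine i j ↑ˡ _)
  position (vleg j (H i)) = shift₃ (combine i j ↑ˡ _)
  position (uleg j (H i)) = shift₄ (combine i j ↑ˡ _)
  position (uleg j Mid)   = shift₅ (j ↑ˡ m)
  position (vleg j Mid)   = shift₅ (m ↑ʳ j)

  legs-combine : ∀ leg col i j → legs leg col (combine i j) ≡ leg j (col i)
  legs-combine leg col = lookup-concat (λ i j → leg j (col i))

  position-legs : ∀ leg col ι → (∀ i j → position (leg j (col i)) ≡ ι (combine i j)) →
                  ∀ t → position (legs leg col t) ≡ ι t
  position-legs leg col = concat-leftInverse (λ i j → leg j (col i)) position

  position-edges : ∀ e → position (edges e) ≡ e
  position-edges =
    ++-leftInverse rung edgesFrom₁ position id (λ _ → refl)
    (++-leftInverse (legs uleg L) edgesFrom₂ position shift₁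
      (position-legs uleg L (shift₁ ∘ (_↑ˡ _)) (λ _ _ → refl))
    (++-leftInverse (legs vleg L) edgesFrom₃ position shift₂
      (position-legs vleg L (shift₂ ∘ (_↑ˡ _)) (λ _ _ → refl))
    (++-leftInverse (legs vleg H) edgesFrom₄ position shift₃
      (position-legs vleg H (shift₃ ∘ (_↑ˡ _)) (λ _ _ → refl))
    (++-leftInverse (legs uleg H) edgesFrom₅ position shift₄
      (position-legs uleg H (shift₄ ∘ (_↑ˡ _)) (λ _ _ → refl))
    (++-leftInverse (flip uleg Mid) (flip vleg Mid) position shift₅ (λ _ → refl) (λ _ → refl))))))

  edges-injective : Injective _≡_ _≡_ edges
  edges-injective = leftInverse⇒injective position position-edges

  edges-shift₁ : ∀ t → edges (shift₁ t) ≡ edgesFrom₁ t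
  edges-shift₁ = lookup-++ʳ rung edgesFrom₁

  edges-shift₂ : ∀ t → edges (shift₂ t) ≡ edgesFrom₂ t
  edges-shift₂ t = trans (edges-shift₁ _) (lookup-++ʳ (legs uleg L) edgesFrom₂ t)

  edges-shift₃ : ∀ t → edges (shift₃ t) ≡ edgesFrom₃ t
  edges-shift₃ t = trans (edges-shift₂ _) (lookup-++ʳ (legs vleg L) edgesFrom₃ t)

  edges-shift₄ : ∀ t → edges (shift₄ t) ≡ edgesFrom₄ t
  edges-shift₄ t = trans (edges-shift₃ _) (lookup-++ʳ (legs vleg H) edgesFrom₄ t)

  edges-shift₅ : ∀ t → edges (shift₅ t) ≡ edgesFrom₅ t
  edges-shift₅ t = trans (edges-shift₄ _) (lookup-++ʳ (legs uleg H) edgesFrom₅ t)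

  edges-position : ∀ ed → edges (position ed) ≡ ed
  edges-position (rung a)       = lookup-++ˡ rung edgesFrom₁ a
  edges-position (uleg j (L i)) =
    trans (edges-shift₁ _) (trans (lookup-++ˡ (legs uleg L) edgesFrom₂ _) (legs-combine uleg L i j))
  edges-position (vleg j (L i)) =
    trans (edges-shift₂ _) (trans (lookup-++ˡ (legs vleg L) edgesFrom₃ _) (legs-combine vleg L i j))
  edges-position (vleg j (H i)) =
    trans (edges-shift₃ _) (trans (lookup-++ˡ (legs vleg H) edgesFrom₄ _) (legs-combine vleg H i j))
  edges-position (uleg j (H i)) =
    trans (edges-shift₄ _) (trans (lookup-++ˡ (legs uleg H) edgesFrom₅ _) (legs-combine uleg H i j))
  edges-position (uleg j Mid)   = trans (edges-shift₅ _) (lookup-++ˡ (flip uleg Mid) (flip vleg Mid) j)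
  edges-position (vleg j Mid)   = trans (edges-shift₅ _) (lookup-++ʳ (flip uleg Mid) (flip vleg Mid) j)

  -- The with-terms must be literally those of endsG (suc (k + k), not N) to be abstracted.
  endsG-edges : ∀ e → endsG n k e ≡ endpoints (edges e)
  endsG-edges e with splitAt (suc (k + k)) e
  ... | inj₁ a = refl
  ... | inj₂ e₁ with splitAt (k * (n + n)) e₁
  ...   | inj₁ t = refl
  ...   | inj₂ e₂ with splitAt (k * (n + n)) e₂
  ...     | inj₁ t = refl
  ...     | inj₂ e₃ with splitAt (k * (n + n)) e₃
  ...       | inj₁ t = refl
  ...       | inj₂ e₄ with splitAt (k * (n + n)) e₄
  ...         | inj₁ t = refl
  ...         | inj₂ e₅ with splitAt (n + n) e₅
  ...           | inj₁ j = refl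
  ...           | inj₂ j = refl

  toℕ-lo : ∀ i → toℕ (lo {k} i) ≡ toℕ i
  toℕ-lo i = toℕ-inject≤ i _

  toℕ-hi : ∀ i → toℕ (hi {k} i) ≡ k + suc (toℕ (opposite i))
  toℕ-hi i = +-cancelˡ-≡ (toℕ i) _ _ (begin
    toℕ i + toℕ (hi i)                     ≡⟨ cong (_+ toℕ (hi i)) (toℕ-lo i) ⟨
    toℕ (lo i) + toℕ (hi i)                ≡⟨ suc-injective (toℕ+toℕ-opposite (lo i)) ⟩
    k + k                                  ≡⟨ cong (k +_) (toℕ+toℕ-opposite i) ⟨
    k + suc (toℕ i + toℕ (opposite i))     ≡⟨ shuffle k (toℕ i) (toℕ (opposite i)) ⟩
    toℕ i + (k + suc (toℕ (opposite i)))   ∎)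
    where
    shuffle : ∀ k a b → k + suc (a + b) ≡ a + (k + suc b)
    shuffle = solve-∀

  toℕ-mid : toℕ (mid k) ≡ k
  toℕ-mid = toℕ-fromℕ< _

  lo<k : ∀ i → toℕ (lo {k} i) < k
  lo<k i = subst (_< k) (sym (toℕ-lo i)) (toℕ<n i)

  k<hi : ∀ i → k < toℕ (hi {k} i)
  k<hi i = subst (k <_) (sym (toℕ-hi i)) (m<m+n k (s≤s z≤n))

  lo-injective : Injective _≡_ _≡_ (lo {k})
  lo-injective {i} {j} eq = toℕ-injective (trans (sym (toℕ-lo i)) (trans (cong toℕ eq) (toℕ-lo j)))

  lo-fromℕ< : ∀ {a : Fin N} (a<k : toℕ a < k) → lo (fromℕ< a<k) ≡ a
  lo-fromℕ< a<k = toℕ-injective (trans (toℕ-lo _) (toℕ-fromℕ< a<k))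

  anchor-injective : Injective _≡_ _≡_ anchor
  anchor-injective {L i} {L j} eq = cong L (lo-injective eq)
  anchor-injective {L i} {H j} eq = contradiction (cong toℕ eq) (<⇒≢ (<-trans (lo<k i) (k<hi j)))
  anchor-injective {L i} {Mid} eq = contradiction (trans (cong toℕ eq) toℕ-mid) (<⇒≢ (lo<k i))
  anchor-injective {H i} {L j} eq = contradiction (cong toℕ eq) (>⇒≢ (<-trans (lo<k j) (k<hi i)))
  anchor-injective {H i} {H j} eq = cong H (lo-injective (opposite-injective eq))
  anchor-injective {H i} {Mid} eq = contradiction (trans (cong toℕ eq) toℕ-mid) (>⇒≢ (k<hi i))
  anchor-injective {Mid} {L j} eq = contradiction (trans (sym toℕ-mid) (cong toℕ eq)) (>⇒≢ (lo<k j))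
  anchor-injective {Mid} {H j} eq = contradiction (trans (sym toℕ-mid) (cong toℕ eq)) (<⇒≢ (k<hi j))
  anchor-injective {Mid} {Mid} eq = refl

  anchor-surjective : ∀ a → ∃[ col ] anchor col ≡ a
  anchor-surjective a with <-cmp (toℕ a) k
  ... | tri< a<k _ _ = L (fromℕ< a<k) , lo-fromℕ< a<k
  ... | tri≈ _ a≡k _ = Mid , toℕ-injective (trans toℕ-mid (sym a≡k))
  ... | tri> _ _ k<a = H (fromℕ< a′<k) , trans (cong opposite (lo-fromℕ< a′<k)) (opposite-involutive a)
    where
    a′<k : toℕ (opposite a) < k
    a′<k = +-cancelˡ-< k _ _
      (subst (k + toℕ (opposite a) <_) (suc-injective (toℕ+toℕ-opposite a)) (+-monoˡ-< (toℕ (opposite a)) k<a))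

  swap-involutive : ∀ col → swap (swap col) ≡ col
  swap-involutive (L i) = refl
  swap-involutive (H i) = refl
  swap-involutive Mid   = refl

  anchor-swap : ∀ col → anchor (swap col) ≡ opposite (anchor col)
  anchor-swap (L i) = refl
  anchor-swap (H i) = sym (opposite-involutive (lo i))
  anchor-swap Mid   = toℕ-injective (+-cancelˡ-≡ k _ _ (begin
    k + toℕ (mid k)                  ≡⟨ cong (k +_) toℕ-mid ⟩
    k + k                            ≡⟨ suc-injective (toℕ+toℕ-opposite (mid k)) ⟨
    toℕ (mid k) + toℕ (opposite (mid k)) ≡⟨ cong (_+ toℕ (opposite (mid k))) toℕ-mid ⟩
    k + toℕ (opposite (mid k))       ∎))

  anchor∘swap-injective : Injective _≡_ _≡_ (anchor ∘ swap)
  anchor∘swap-injective {col} {col′} eq = begin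
    col               ≡⟨ swap-involutive col ⟨
    swap (swap col)   ≡⟨ cong swap (anchor-injective eq) ⟩
    swap (swap col′)  ≡⟨ swap-involutive col′ ⟩
    col′              ∎

  -- anchor, p₀ and p₁ are the rows of a 3 × (2k + 1) magic rectangle: permutations of the columns
  -- whose values add up to 3k in every column.
  double : Fin k → Fin 2 → Fin N
  double i b = inject₁ (cast k*2≡k+k (combine i b))
    where
    k*2≡k+k : k * 2 ≡ k + k
    k*2≡k+k = trans (*-comm k 2) (cong (k +_) (+-identityʳ k))

  toℕ-double : ∀ i b → toℕ (double i b) ≡ 2 * toℕ i + toℕ b
  toℕ-double i b = trans (toℕ-inject₁ _) (trans (toℕ-cast _ _) (toℕ-combine i b))

  double-injective : ∀ {i b i′ b′} → double i b ≡ double i′ b′ → i ≡ i′ × b ≡ b′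
  double-injective {i} {b} {i′} {b′} eq = combine-injective i b i′ b′ (toℕ-injective (begin
    toℕ (combine i b)             ≡⟨ toℕ-cast _ _ ⟨
    toℕ (cast _ (combine i b))    ≡⟨ cong toℕ (inject₁-injective eq) ⟩
    toℕ (cast _ (combine i′ b′))  ≡⟨ toℕ-cast _ _ ⟩
    toℕ (combine i′ b′)           ∎))

  p₀ p₁ : Col → Fin N
  p₀ (L i) = double (opposite i) (suc zero)
  p₀ (H i) = double i zero
  p₀ Mid   = fromℕ (k + k)
  p₁ (L i) = suc (k ↑ʳ i)
  p₁ (H i) = suc (opposite i ↑ˡ k)
  p₁ Mid   = zero

  p₀-injective : Injective _≡_ _≡_ p₀
  p₀-injective {L i} {L j} eq = cong L (opposite-injective (proj₁ (double-injective eq)))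
  p₀-injective {L i} {H j} eq = contradiction (proj₂ (double-injective eq)) λ ()
  p₀-injective {L i} {Mid} eq = contradiction (sym eq) fromℕ≢inject₁
  p₀-injective {H i} {L j} eq = contradiction (proj₂ (double-injective eq)) λ ()
  p₀-injective {H i} {H j} eq = cong H (proj₁ (double-injective eq))
  p₀-injective {H i} {Mid} eq = contradiction (sym eq) fromℕ≢inject₁
  p₀-injective {Mid} {L j} eq = contradiction eq fromℕ≢inject₁
  p₀-injective {Mid} {H j} eq = contradiction eq fromℕ≢inject₁
  p₀-injective {Mid} {Mid} eq = refl

  p₁-injective : Injective _≡_ _≡_ p₁
  p₁-injective {L i} {L j} eq = cong L (↑ʳ-injective k i j (fsuc-injective eq))
  p₁-injective {L i} {H j} eq =
    contradiction (join-injective k k {inj₂ i} {inj₁ (opposite j)} (fsuc-injective eq)) λ ()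
  p₁-injective {H i} {L j} eq =
    contradiction (join-injective k k {inj₁ (opposite i)} {inj₂ j} (fsuc-injective eq)) λ ()
  p₁-injective {H i} {H j} eq = cong H (opposite-injective (↑ˡ-injective k _ _ (fsuc-injective eq)))
  p₁-injective {Mid} {Mid} eq = refl

  anchor+p₀+p₁≡3k : ∀ col → toℕ (anchor col) + toℕ (p₀ col) + toℕ (p₁ col) ≡ 3 * k
  anchor+p₀+p₁≡3k (L i) rewrite toℕ-lo i | toℕ-double (opposite i) (suc zero) | toℕ-↑ʳ k i =
    subst (λ k → toℕ i + (2 * toℕ (opposite i) + 1) + suc (k + toℕ i) ≡ 3 * k)
          (toℕ+toℕ-opposite i) (identity (toℕ i) (toℕ (opposite i)))
    where
    identity : ∀ a b → a + (2 * b + 1) + suc (suc (a + b) + a) ≡ 3 * suc (a + b)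
    identity = solve-∀
  anchor+p₀+p₁≡3k (H i) rewrite toℕ-hi i | toℕ-double i zero | toℕ-↑ˡ (opposite i) k =
    subst (λ k → k + suc (toℕ (opposite i)) + (2 * toℕ i + 0) + suc (toℕ (opposite i)) ≡ 3 * k)
          (toℕ+toℕ-opposite i) (identity (toℕ i) (toℕ (opposite i)))
    where
    identity : ∀ a b → suc (a + b) + suc b + (2 * a + 0) + suc b ≡ 3 * suc (a + b)
    identity = solve-∀
  anchor+p₀+p₁≡3k Mid rewrite toℕ-mid | toℕ-fromℕ (k + k) = identity k
    where
    identity : ∀ k → k + (k + k) + 0 ≡ 3 * k
    identity = solve-∀

  withHead : (Col → Fin N) → (Col → Fin N) → Vector (Col → Fin N) n
  withHead π π′ zero    = π
  withHead π π′ (suc _) = π′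

  ρ : Vector (Col → Fin N) m
  ρ = withHead p₀ anchor ++ withHead p₁ (opposite ∘ anchor)

  ρ-injective : ∀ j → Injective _≡_ _≡_ (ρ j)
  ρ-injective j = by-block (splitAt n j)
    where
    by-block : ∀ s → Injective _≡_ _≡_ (Sum.[ withHead p₀ anchor , withHead p₁ (opposite ∘ anchor) ] s)
    by-block (inj₁ zero)    = p₀-injective
    by-block (inj₁ (suc _)) = anchor-injective
    by-block (inj₂ zero)    = p₁-injective
    by-block (inj₂ (suc _)) = anchor-injective ∘ opposite-injective

  anchor+∑ρ : ∀ col → toℕ (anchor col) + ∑[ j < m ] toℕ (ρ j col) ≡ 3 * k + n′ * (k + k)
  anchor+∑ρ col = begin
    a + ∑[ j < m ] toℕ (ρ j col)
      ≡⟨ cong (a +_) (∑-++ (λ π → toℕ (π col)) (withHead p₀ anchor) (withHead p₁ (opposite ∘ anchor))) ⟩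
    a + ((a₀ + ∑[ j < n′ ] a) + (a₁ + ∑[ j < n′ ] a′))
      ≡⟨ cong (a +_) (cong₂ _+_ (cong (a₀ +_) (∑-const n′ a)) (cong (a₁ +_) (∑-const n′ a′))) ⟩
    a + ((a₀ + n′ * a) + (a₁ + n′ * a′))
      ≡⟨ regroup a a₀ a₁ a′ n′ ⟩
    (a + a₀ + a₁) + n′ * (a + a′)
      ≡⟨ cong₂ (λ s t → s + n′ * t) (anchor+p₀+p₁≡3k col)
               (suc-injective (toℕ+toℕ-opposite (anchor col))) ⟩
    3 * k + n′ * (k + k)
      ∎
    where
    a a₀ a₁ a′ : ℕ
    a  = toℕ (anchor col)
    a₀ = toℕ (p₀ col)
    a₁ = toℕ (p₁ col)
    a′ = toℕ (opposite (anchor col))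
    regroup : ∀ a a₀ a₁ a′ n′ → a + ((a₀ + n′ * a) + (a₁ + n′ * a′)) ≡ (a + a₀ + a₁) + n′ * (a + a′)
    regroup = solve-∀

  -- By toℕ-combine, u-leg j of column col has rank N j + ρ j col.
  legRank : Fin m → Col → Fin P
  legRank j col = combine j (ρ j col)

  legRank-injective : ∀ {j col j′ col′} → legRank j col ≡ legRank j′ col′ → j ≡ j′ × col ≡ col′
  legRank-injective {j} {col} {j′} {col′} eq with combine-injective j (ρ j col) j′ (ρ j′ col′) eq
  ... | refl , ρ≡ = refl , ρ-injective j ρ≡

  -- rank is the label minus one: the u-legs take 0 … P − 1, the v-leg at the same leaf the mirror
  -- rank in P … 2P − 1, and the rungs the last N ranks.
  rank : Edge → ℕ
  rank (uleg j col) = toℕ (legRank j col)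
  rank (vleg j col) = P + toℕ (opposite (legRank j col))
  rank (rung a)     = P + (P + toℕ a)

  toℕ<P+ : ∀ (i : Fin P) {x} → toℕ i < P + x
  toℕ<P+ i = <-≤-trans (toℕ<n i) (m≤m+n P _)

  rank<qG : ∀ ed → rank ed < qG n k
  rank<qG ed = subst (rank ed <_) (sym (edge-count n k)) (bound ed)
    where
    bound : ∀ ed → rank ed < P + (P + N)
    bound (uleg j col) = toℕ<P+ (legRank j col)
    bound (vleg j col) = +-monoʳ-< P (toℕ<P+ (opposite (legRank j col)))
    bound (rung a)     = +-monoʳ-< P (+-monoʳ-< P (toℕ<n a))

  rank-injective : ∀ {ed ed′} → rank ed ≡ rank ed′ → ed ≡ ed′
  rank-injective {uleg j col} {uleg j′ col′} eq =
    uncurry (cong₂ uleg) (legRank-injective (toℕ-injective eq))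
  rank-injective {vleg j col} {vleg j′ col′} eq =
    uncurry (cong₂ vleg) (legRank-injective (opposite-injective (toℕ-injective (+-cancelˡ-≡ P _ _ eq))))
  rank-injective {rung a} {rung a′} eq =
    cong rung (toℕ-injective (+-cancelˡ-≡ P _ _ (+-cancelˡ-≡ P _ _ eq)))
  rank-injective {uleg j col} {vleg _ _}   eq = contradiction eq (<⇒≢ (toℕ<P+ (legRank j col)))
  rank-injective {uleg j col} {rung _}     eq = contradiction eq (<⇒≢ (toℕ<P+ (legRank j col)))
  rank-injective {vleg _ _}   {uleg j col} eq = contradiction eq (>⇒≢ (toℕ<P+ (legRank j col)))
  rank-injective {rung _}     {uleg j col} eq = contradiction eq (>⇒≢ (toℕ<P+ (legRank j col)))
  rank-injective {vleg j col} {rung _}     eq =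
    contradiction (+-cancelˡ-≡ P _ _ eq) (<⇒≢ (toℕ<P+ (opposite (legRank j col))))
  rank-injective {rung _}     {vleg j col} eq =
    contradiction (+-cancelˡ-≡ P _ _ eq) (>⇒≢ (toℕ<P+ (opposite (legRank j col))))

  σ : Fin (qG n k) → Fin (qG n k)
  σ e = fromℕ< (rank<qG (edges e))

  σ-injective : Injective _≡_ _≡_ σ
  σ-injective {e} {e′} eq = edges-injective (rank-injective (begin
    rank (edges e)   ≡⟨ toℕ-fromℕ< (rank<qG (edges e)) ⟨
    toℕ (σ e)        ≡⟨ cong toℕ eq ⟩
    toℕ (σ e′)       ≡⟨ toℕ-fromℕ< (rank<qG (edges e′)) ⟩
    rank (edges e′)  ∎))

  labeling : Labeling graph
  labeling = mk⤖ (σ-injective , injective⇒surjective σ σ-injective)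

  label-edges : ∀ e → label graph labeling e ≡ suc (rank (edges e))
  label-edges e = cong suc (toℕ-fromℕ< (rank<qG (edges e)))

  sumCol : (Col → ℕ) → ℕ
  sumCol F = ∑[ i < k ] F (L i) + (∑[ i < k ] F (H i) + F Mid)

  sumCol-zero : ∀ {F} → (∀ col → F col ≡ 0) → sumCol F ≡ 0
  sumCol-zero F≗0 = cong₂ _+_ (∑-zero (F≗0 ∘ L)) (cong₂ _+_ (∑-zero (F≗0 ∘ H)) (F≗0 Mid))

  sumCol-single : ∀ F col → (∀ col′ → col′ ≢ col → F col′ ≡ 0) → sumCol F ≡ F col
  sumCol-single F (L i) F≗0 = trans
    (cong₂ _+_ (∑-single (F ∘ L) i λ j j≢i → F≗0 (L j) (j≢i ∘ λ { refl → refl }))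
               (cong₂ _+_ (∑-zero λ j → F≗0 (H j) λ ()) (F≗0 Mid λ ())))
    (+-identityʳ (F (L i)))
  sumCol-single F (H i) F≗0 = trans
    (cong₂ _+_ (∑-zero λ j → F≗0 (L j) λ ())
               (cong₂ _+_ (∑-single (F ∘ H) i λ j j≢i → F≗0 (H j) (j≢i ∘ λ { refl → refl }))
                          (F≗0 Mid λ ())))
    (+-identityʳ (F (H i)))
  sumCol-single F Mid F≗0 =
    cong₂ _+_ (∑-zero λ j → F≗0 (L j) λ ()) (cong₂ _+_ (∑-zero λ j → F≗0 (H j) λ ()) refl)

  edgeSum : (Edge → ℕ) → ℕ
  edgeSum h = ∑[ a < N ] h (rung a)
            + (sumCol (λ col → ∑[ j < m ] h (uleg j col)) + sumCol (λ col → ∑[ j < m ] h (vleg j col)))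

  ∑-legs : ∀ h leg col → ∑[ t < k * m ] h (legs leg col t) ≡ ∑[ i < k ] ∑[ j < m ] h (leg j (col i))
  ∑-legs h leg col = ∑-concat h (λ i j → leg j (col i))

  ∑-edges : ∀ h → ∑[ e < qG n k ] h (edges e) ≡ edgeSum h
  ∑-edges h =
    trans (∑-++ h rung edgesFrom₁) (cong (∑[ a < N ] h (rung a) +_) (trans
      (trans (∑-++ h (legs uleg L) edgesFrom₂) (cong₂ _+_ (∑-legs h uleg L)
      (trans (∑-++ h (legs vleg L) edgesFrom₃) (cong₂ _+_ (∑-legs h vleg L)
      (trans (∑-++ h (legs vleg H) edgesFrom₄) (cong₂ _+_ (∑-legs h vleg H)
      (trans (∑-++ h (legs uleg H) edgesFrom₅) (cong₂ _+_ (∑-legs h uleg H)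
      (∑-++ h (flip uleg Mid) (flip vleg Mid))))))))))
      (regroup (block uleg L) (block vleg L) (block vleg H) (block uleg H) (mid-block uleg) (mid-block vleg))))
    where
    block : (Fin m → Col → Edge) → (Fin k → Col) → ℕ
    block leg col = ∑[ i < k ] ∑[ j < m ] h (leg j (col i))
    mid-block : (Fin m → Col → Edge) → ℕ
    mid-block leg = ∑[ j < m ] h (leg j Mid)
    regroup : ∀ a b c d e f → a + (b + (c + (d + (e + f)))) ≡ (a + (d + e)) + (b + (c + f))
    regroup = solve-∀

  labelAt : Vtx n k → Edge → ℕ
  labelAt w ed = incidentLabel graph w (endpoints ed) (suc (rank ed))

  labelAt-endpoint : ∀ w ed → w ≡ proj₁ (endpoints ed) ⊎ w ≡ proj₂ (endpoints ed) →
                     labelAt w ed ≡ suc (rank ed)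
  labelAt-endpoint w ed = incidentLabel-endpoint graph (endpoints ed) _

  labelAt-elsewhere : ∀ w ed → w ≢ proj₁ (endpoints ed) → w ≢ proj₂ (endpoints ed) → labelAt w ed ≡ 0
  labelAt-elsewhere w ed = incidentLabel-elsewhere graph (endpoints ed) _

  fplus-edgeSum : ∀ w → fplus graph labeling w ≡ edgeSum (labelAt w)
  fplus-edgeSum w = begin
    fplus graph labeling w
      ≡⟨ fplus-∑ graph labeling w ⟩
    ∑[ e < qG n k ] incidentLabel graph w (endsG n k e) (label graph labeling e)
      ≡⟨ sum-cong-≗ (λ e → cong₂ (incidentLabel graph w) (endsG-edges e) (label-edges e)) ⟩
    ∑[ e < qG n k ] labelAt w (edges e)
      ≡⟨ ∑-edges (labelAt w) ⟩
    edgeSum (labelAt w)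
      ∎

  u-injective : ∀ {a b} → u {n} {k} a ≡ u b → a ≡ b
  u-injective refl = refl

  v-injective : ∀ {a b} → v {n} {k} a ≡ v b → a ≡ b
  v-injective refl = refl

  u≢leaf : ∀ {a j} col → u a ≢ leaf j col
  u≢leaf (L _) ()
  u≢leaf (H _) ()
  u≢leaf Mid   ()

  v≢leaf : ∀ {a j} col → v a ≢ leaf j col
  v≢leaf (L _) ()
  v≢leaf (H _) ()
  v≢leaf Mid   ()

  leaf-injective : ∀ {j col j′ col′} → leaf j col ≡ leaf j′ col′ → j ≡ j′ × col ≡ col′
  leaf-injective {col = L _} {col′ = L _} refl = refl , refl
  leaf-injective {col = H _} {col′ = H _} refl = refl , refl
  leaf-injective {col = Mid} {col′ = Mid} refl = refl , refl
  leaf-injective {col = L _} {col′ = H _} ()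
  leaf-injective {col = L _} {col′ = Mid} ()
  leaf-injective {col = H _} {col′ = L _} ()
  leaf-injective {col = H _} {col′ = Mid} ()
  leaf-injective {col = Mid} {col′ = L _} ()
  leaf-injective {col = Mid} {col′ = H _} ()

  fplus-u : ∀ col → fplus graph labeling (u (anchor col))
                    ≡ suc (rank (rung (anchor col))) + ∑[ j < m ] suc (rank (uleg j col))
  fplus-u col = trans (fplus-edgeSum w) (cong₂ _+_ from-rungs (trans (cong₂ _+_ from-ulegs from-vlegs) (+-identityʳ _)))
    where
    w : Vtx n k
    w = u (anchor col)
    from-rungs : ∑[ a < N ] labelAt w (rung a) ≡ suc (rank (rung (anchor col)))
    from-rungs = trans (∑-single (labelAt w ∘ rung) (anchor col) λ a a≢ →
                          labelAt-elsewhere w (rung a) (a≢ ∘ sym ∘ u-injective) λ ())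
                       (labelAt-endpoint w (rung (anchor col)) (inj₁ refl))
    from-ulegs : sumCol (λ col′ → ∑[ j < m ] labelAt w (uleg j col′)) ≡ ∑[ j < m ] suc (rank (uleg j col))
    from-ulegs = trans (sumCol-single _ col λ col′ col′≢col → ∑-zero λ j →
                          labelAt-elsewhere w (uleg j col′)
                            (col′≢col ∘ sym ∘ anchor-injective ∘ u-injective) (u≢leaf col′))
                       (sum-cong-≗ λ j → labelAt-endpoint w (uleg j col) (inj₁ refl))
    from-vlegs : sumCol (λ col′ → ∑[ j < m ] labelAt w (vleg j col′)) ≡ 0
    from-vlegs = sumCol-zero λ col′ → ∑-zero λ j → labelAt-elsewhere w (vleg j col′) (λ ()) (u≢leaf col′)

  fplus-v : ∀ col → fplus graph labeling (v (anchor (swap col)))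
                    ≡ suc (rank (rung (anchor (swap col)))) + ∑[ j < m ] suc (rank (vleg j col))
  fplus-v col = trans (fplus-edgeSum w) (cong₂ _+_ from-rungs (cong₂ _+_ from-ulegs from-vlegs))
    where
    w : Vtx n k
    w = v (anchor (swap col))
    from-rungs : ∑[ a < N ] labelAt w (rung a) ≡ suc (rank (rung (anchor (swap col))))
    from-rungs = trans (∑-single (labelAt w ∘ rung) (anchor (swap col)) λ a a≢ →
                          labelAt-elsewhere w (rung a) (λ ()) (a≢ ∘ sym ∘ v-injective))
                       (labelAt-endpoint w (rung (anchor (swap col))) (inj₂ refl))
    from-ulegs : sumCol (λ col′ → ∑[ j < m ] labelAt w (uleg j col′)) ≡ 0
    from-ulegs = sumCol-zero λ col′ → ∑-zero λ j → labelAt-elsewhere w (uleg j col′) (λ ()) (v≢leaf col′)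
    from-vlegs : sumCol (λ col′ → ∑[ j < m ] labelAt w (vleg j col′)) ≡ ∑[ j < m ] suc (rank (vleg j col))
    from-vlegs = trans (sumCol-single _ col λ col′ col′≢col → ∑-zero λ j →
                          labelAt-elsewhere w (vleg j col′)
                            (col′≢col ∘ sym ∘ anchor∘swap-injective ∘ v-injective) (v≢leaf col′))
                       (sum-cong-≗ λ j → labelAt-endpoint w (vleg j col) (inj₁ refl))

  fplus-leaf : ∀ j col → fplus graph labeling (leaf j col) ≡ suc (rank (uleg j col)) + suc (rank (vleg j col))
  fplus-leaf j col = trans (fplus-edgeSum w) (cong₂ _+_ from-rungs (cong₂ _+_
    (from-legs uleg (λ _ _ → refl) (λ _ → u≢leaf col ∘ sym))
    (from-legs vleg (λ _ _ → refl) (λ _ → v≢leaf col ∘ sym))))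
    where
    w : Vtx n k
    w = leaf j col
    from-rungs : ∑[ a < N ] labelAt w (rung a) ≡ 0
    from-rungs = ∑-zero λ a → labelAt-elsewhere w (rung a) (u≢leaf col ∘ sym) (v≢leaf col ∘ sym)
    from-legs : ∀ (leg : Fin m → Col → Edge) →
                (∀ j′ col′ → proj₂ (endpoints (leg j′ col′)) ≡ leaf j′ col′) →
                (∀ col′ {j′} → w ≢ proj₁ (endpoints (leg j′ col′))) →
                sumCol (λ col′ → ∑[ j′ < m ] labelAt w (leg j′ col′)) ≡ suc (rank (leg j col))
    from-legs leg leaf-end w≢hub = begin
      sumCol (λ col′ → ∑[ j′ < m ] labelAt w (leg j′ col′))
        ≡⟨ sumCol-single _ col (λ col′ col′≢col → ∑-zero λ j′ →
             labelAt-elsewhere w (leg j′ col′) (w≢hub col′)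
               (col′≢col ∘ sym ∘ proj₂ ∘ leaf-injective ∘ λ eq → trans eq (leaf-end j′ col′))) ⟩
      ∑[ j′ < m ] labelAt w (leg j′ col)
        ≡⟨ ∑-single _ j (λ j′ j′≢j → labelAt-elsewhere w (leg j′ col) (w≢hub col)
             (j′≢j ∘ sym ∘ proj₁ ∘ leaf-injective ∘ λ eq → trans eq (leaf-end j′ col))) ⟩
      labelAt w (leg j col)
        ≡⟨ labelAt-endpoint w (leg j col) (inj₂ (sym (leaf-end j col))) ⟩
      suc (rank (leg j col))
        ∎

  leafColor uColor vColor : ℕ
  leafColor = suc (P + P)
  uColor    = leafColor + (m + N * ∑[ j < m ] toℕ j + (3 * k + n′ * (k + k)))
  vColor    = uColor + m * P

  leafColor<uColor : leafColor < uColor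
  leafColor<uColor = m<m+n leafColor (s≤s z≤n)

  uColor<vColor : uColor < vColor
  uColor<vColor = m<m+n uColor (s≤s z≤n)

  uleg+vleg≡leafColor : ∀ j col → suc (rank (uleg j col)) + suc (rank (vleg j col)) ≡ leafColor
  uleg+vleg≡leafColor j col =
    subst (λ p → suc a + suc (p + a′) ≡ suc (p + p)) (toℕ+toℕ-opposite (legRank j col)) (identity a a′)
    where
    a a′ : ℕ
    a  = toℕ (legRank j col)
    a′ = toℕ (opposite (legRank j col))
    identity : ∀ a a′ → suc a + suc (suc (a + a′) + a′) ≡ suc (suc (a + a′) + suc (a + a′))
    identity = solve-∀

  ∑-uleg : ∀ col → ∑[ j < m ] suc (rank (uleg j col)) ≡ m + (N * ∑[ j < m ] toℕ j + ∑[ j < m ] toℕ (ρ j col))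
  ∑-uleg col = begin
    ∑[ j < m ] suc (toℕ (legRank j col))
      ≡⟨ ∑-suc m (λ j → toℕ (legRank j col)) ⟩
    m + ∑[ j < m ] toℕ (legRank j col)
      ≡⟨ cong (m +_) (sum-cong-≗ λ j → toℕ-combine j (ρ j col)) ⟩
    m + ∑[ j < m ] (N * toℕ j + toℕ (ρ j col))
      ≡⟨ cong (m +_) (∑-distrib-+ (λ j → N * toℕ j) (λ j → toℕ (ρ j col))) ⟩
    m + (∑[ j < m ] (N * toℕ j) + ∑[ j < m ] toℕ (ρ j col))
      ≡⟨ cong (λ t → m + (t + ∑[ j < m ] toℕ (ρ j col))) (*-distribˡ-sum {m} N toℕ) ⟨
    m + (N * ∑[ j < m ] toℕ j + ∑[ j < m ] toℕ (ρ j col))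
      ∎

  rung+ulegs≡uColor : ∀ col → suc (rank (rung (anchor col))) + ∑[ j < m ] suc (rank (uleg j col)) ≡ uColor
  rung+ulegs≡uColor col = begin
    suc (P + (P + a)) + ∑[ j < m ] suc (rank (uleg j col))
      ≡⟨ cong (suc (P + (P + a)) +_) (∑-uleg col) ⟩
    suc (P + (P + a)) + (m + (N * G + R))
      ≡⟨ shuffle P a m (N * G) R ⟩
    leafColor + (m + N * G + (a + R))
      ≡⟨ cong (λ t → leafColor + (m + N * G + t)) (anchor+∑ρ col) ⟩
    uColor
      ∎
    where
    a G R : ℕ
    a = toℕ (anchor col)
    G = ∑[ j < m ] toℕ j
    R = ∑[ j < m ] toℕ (ρ j col)
    shuffle : ∀ P a m X R → suc (P + (P + a)) + (m + (X + R)) ≡ suc (P + P) + (m + X + (a + R))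
    shuffle = solve-∀

  rung+vlegs≡vColor : ∀ col → suc (rank (rung (anchor (swap col)))) + ∑[ j < m ] suc (rank (vleg j col)) ≡ vColor
  rung+vlegs≡vColor col = +-cancelʳ-≡ uColor _ _ (begin
    (r′ + Σv) + uColor                                     ≡⟨ cong ((r′ + Σv) +_) (rung+ulegs≡uColor col) ⟨
    (r′ + Σv) + (r + Σu)                                   ≡⟨ shuffle r′ Σv r Σu ⟩
    (r′ + r) + (Σu + Σv)                                   ≡⟨ cong₂ _+_ rungs leg-pairs ⟩
    suc (suc (P + P + (P + P) + (k + k))) + m * leafColor  ≡⟨ color-balance n′ k _ (∑-toℕ (n′ + n)) ⟨
    vColor + uColor                                        ∎)
    where
    r r′ Σu Σv : ℕ
    r  = suc (rank (rung (anchor col)))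
    r′ = suc (rank (rung (anchor (swap col))))
    Σu = ∑[ j < m ] suc (rank (uleg j col))
    Σv = ∑[ j < m ] suc (rank (vleg j col))
    shuffle : ∀ r′ Σv r Σu → (r′ + Σv) + (r + Σu) ≡ (r′ + r) + (Σu + Σv)
    shuffle = solve-∀
    leg-pairs : Σu + Σv ≡ m * leafColor
    leg-pairs = begin
      Σu + Σv
        ≡⟨ ∑-distrib-+ (λ j → suc (rank (uleg j col))) (λ j → suc (rank (vleg j col))) ⟨
      ∑[ j < m ] (suc (rank (uleg j col)) + suc (rank (vleg j col)))
        ≡⟨ sum-cong-≗ (λ j → uleg+vleg≡leafColor j col) ⟩
      ∑[ j < m ] leafColor
        ≡⟨ ∑-const m leafColor ⟩
      m * leafColor
        ∎
    anchors : toℕ (anchor (swap col)) + toℕ (anchor col) ≡ k + k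
    anchors = begin
      toℕ (anchor (swap col)) + toℕ (anchor col)      ≡⟨ cong (λ b → toℕ b + toℕ (anchor col)) (anchor-swap col) ⟩
      toℕ (opposite (anchor col)) + toℕ (anchor col)  ≡⟨ +-comm _ (toℕ (anchor col)) ⟩
      toℕ (anchor col) + toℕ (opposite (anchor col))  ≡⟨ suc-injective (toℕ+toℕ-opposite (anchor col)) ⟩
      k + k                                           ∎
    rungs : r′ + r ≡ suc (suc (P + P + (P + P) + (k + k)))
    rungs = trans (identity P (toℕ (anchor (swap col))) (toℕ (anchor col)))
                  (cong (λ t → suc (suc (P + P + (P + P) + t))) anchors)
      where
      identity : ∀ P a′ a → suc (P + (P + a′)) + suc (P + (P + a)) ≡ suc (suc (P + P + (P + P) + (a′ + a)))
      identity = solve-∀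

  color : Vtx n k → ℕ
  color (u _)   = uColor
  color (v _)   = vColor
  color (y _ _) = leafColor
  color (z _ _) = leafColor
  color (x _)   = leafColor

  color-leaf : ∀ j col → color (leaf j col) ≡ leafColor
  color-leaf j (L i) = refl
  color-leaf j (H i) = refl
  color-leaf j Mid   = refl

  fplus-u≡uColor : ∀ a → fplus graph labeling (u a) ≡ uColor
  fplus-u≡uColor a =
    let (col , anchor≡a) = anchor-surjective a in
    subst (λ b → fplus graph labeling (u b) ≡ uColor) anchor≡a (trans (fplus-u col) (rung+ulegs≡uColor col))

  fplus-v≡vColor : ∀ a → fplus graph labeling (v a) ≡ vColor
  fplus-v≡vColor a =
    let (col , anchor≡a) = anchor-surjective a in
    subst (λ b → fplus graph labeling (v b) ≡ vColor) (trans (cong anchor (swap-involutive col)) anchor≡a)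
          (trans (fplus-v (swap col)) (rung+vlegs≡vColor (swap col)))

  fplus-leaf≡leafColor : ∀ j col → fplus graph labeling (leaf j col) ≡ leafColor
  fplus-leaf≡leafColor j col = trans (fplus-leaf j col) (uleg+vleg≡leafColor j col)

  fplus≡color : ∀ w → fplus graph labeling w ≡ color w
  fplus≡color (u a)   = fplus-u≡uColor a
  fplus≡color (v a)   = fplus-v≡vColor a
  fplus≡color (y i j) = fplus-leaf≡leafColor j (L i)
  fplus≡color (z i j) = fplus-leaf≡leafColor j (H i)
  fplus≡color (x j)   = fplus-leaf≡leafColor j Mid

  endpoint-colors-differ : ∀ ed → color (proj₁ (endpoints ed)) ≢ color (proj₂ (endpoints ed))
  endpoint-colors-differ (rung a)     = <⇒≢ uColor<vColor
  endpoint-colors-differ (uleg j col) rewrite color-leaf j col = >⇒≢ leafColor<uColor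
  endpoint-colors-differ (vleg j col) rewrite color-leaf j col = >⇒≢ (<-trans leafColor<uColor uColor<vColor)

  fplus-ends≡color : ∀ e (end : Vtx n k × Vtx n k → Vtx n k) →
                     fplus graph labeling (end (endsG n k e)) ≡ color (end (endpoints (edges e)))
  fplus-ends≡color e end =
    trans (cong (fplus graph labeling ∘ end) (endsG-edges e)) (fplus≡color (end (endpoints (edges e))))

  antimagic : LocalAntimagic graph labeling
  antimagic e same = endpoint-colors-differ (edges e)
    (trans (sym (fplus-ends≡color e proj₁)) (trans same (fplus-ends≡color e proj₂)))

  colorNumber : ColorNumber graph labeling 3
  colorNumber = colors , distinct , colored , attained , refl
    where
    colors : List ℕ
    colors = leafColor ∷ uColor ∷ vColor ∷ []
    distinct : Unique colors
    distinct = (<⇒≢ leafColor<uColor ∷ <⇒≢ (<-trans leafColor<uColor uColor<vColor) ∷ [])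
             ∷ (<⇒≢ uColor<vColor ∷ []) ∷ [] ∷ []
    color∈colors : ∀ w → color w ∈ colors
    color∈colors (u _)   = there (here refl)
    color∈colors (v _)   = there (there (here refl))
    color∈colors (y _ _) = here refl
    color∈colors (z _ _) = here refl
    color∈colors (x _)   = here refl
    colored : ∀ w → fplus graph labeling w ∈ colors
    colored w = subst (_∈ colors) (sym (fplus≡color w)) (color∈colors w)
    attained : ∀ c → c ∈ colors → ∃[ w ] fplus graph labeling w ≡ c
    attained _ (here refl)                 = x zero , fplus≡color (x zero)
    attained _ (there (here refl))         = u (mid k) , fplus≡color (u (mid k))
    attained _ (there (there (here refl))) = v (mid k) , fplus≡color (v (mid k))

  triangle : Fin 3 → Vtx n k
  triangle zero             = u (mid k)
  triangle (suc zero)       = v (mid k)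
  triangle (suc (suc zero)) = x zero

  edge-adjacent : ∀ ed → Adjacent graph (proj₁ (endpoints ed)) (proj₂ (endpoints ed))
  edge-adjacent ed = position ed , inj₁ (trans (endsG-edges (position ed)) (cong endpoints (edges-position ed)))

  triangle-clique : IsClique graph triangle
  triangle-clique zero             zero             0≢0 = contradiction refl 0≢0
  triangle-clique zero             (suc zero)       _   = edge-adjacent (rung (mid k))
  triangle-clique zero             (suc (suc zero)) _   = edge-adjacent (uleg zero Mid)
  triangle-clique (suc zero)       zero             _   = Adjacent-sym graph (edge-adjacent (rung (mid k)))
  triangle-clique (suc zero)       (suc zero)       1≢1 = contradiction refl 1≢1
  triangle-clique (suc zero)       (suc (suc zero)) _   = edge-adjacent (vleg zero Mid)
  triangle-clique (suc (suc zero)) zero             _   = Adjacent-sym graph (edge-adjacent (uleg zero Mid))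
  triangle-clique (suc (suc zero)) (suc zero)       _   = Adjacent-sym graph (edge-adjacent (vleg zero Mid))
  triangle-clique (suc (suc zero)) (suc (suc zero)) 2≢2 = contradiction refl 2≢2

theorem2p1 : (n k : ℕ) → 1 ≤ n → 1 ≤ k → χla≡ (G2n n k) 3
theorem2p1 zero     k () _
theorem2p1 (suc n′) k _  _ =
  (labeling , antimagic , colorNumber) ,
  λ f antimagic′ c coloring → clique≤colorNumber graph {f = f} triangle triangle-clique antimagic′ coloring
  where
  open Construction n′ k
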